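{- Let $\mathcal G=(\mathcal V,\mathcal E)$ be a simple directed graph on $n$ nodes in which every node has out-degree at least one, let $\alpha\in(0,1)$, $\epsilon>0$, $s\in\mathcal V$, and let $\bm x^*$ be the unique solution of $\bm x=\alpha\bm e_s+(1-\alpha)\bm A^\top\bm D^{ -1}\bm x$. Run \textsc{FwdPush}$(\mathcal G,\epsilon,\alpha,s)$ with epochs (defined in the context), let $\bm x^t,\bm r^t$ be the estimation and residual vectors at the beginning of epoch $t$, and let $\mathcal S_t$, $\mathcal U_t$ be the sets of active and inactive nodes at the beginning of epoch $t$. Then after epoch $t$, $$\|\bm x^*-\bm x^{t+1}\|_1\le(1-\alpha\gamma_t)\|\bm x^*-\bm x^t\|_1,\qquad \gamma_t:=\frac{\sum_{u\in\mathcal S_t}d_u}{\sum_{v\in\mathcal I_t}d_v}.$$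
   Context: $\bm A$ is the adjacency matrix and $\bm D=\mathrm{diag}(d_1,\dots,d_n)$ the out-degree matrix of $\mathcal G$. \textsc{FwdPush}$(\mathcal G,\epsilon,\alpha,s)$: start with $\bm x=\bm 0$, $\bm r=\bm e_s$, FIFO queue $\mathcal Q=[s,\ddagger]$ where $\ddagger$ is a dummy node. While $\mathcal Q$ contains more than the dummy: pop $u$; if $u=\ddagger$, re-append it and start a new epoch; otherwise set $x_u\leftarrow x_u+\alpha r_u$, for each out-neighbor $v$ of $u$ set $r_v\leftarrow r_v+(1-\alpha)r_u/d_u$ and append $v$ to $\mathcal Q$ if $r_v\ge\epsilon d_v$ and $v\notin\mathcal Q$, then set $r_u\leftarrow 0$. At the beginning of epoch $t$: $\mathcal S_t=\{u:r^t_u\ge\epsilon d_u\}$ (active nodes, exactly those processed in epoch $t$), $\mathcal U_t=\{v:0<r^t_v<\epsilon d_v\}$ (inactive nodes), and $\mathcal I_t=\operatorname{supp}(\bm r^t)$. -}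

module Defs where

open import Data.Nat as ℕ using (ℕ; zero; suc)
open import Data.Fin using (Fin)
open import Data.Fin.Properties using () renaming (_≟_ to _≟ᶠ_)
open import Data.Bool using (Bool; true; false; if_then_else_; _∧_; not)
open import Data.Bool.ListAction using (any)
open import Data.List using (List; []; _∷_; _++_; allFin; foldr)
open import Data.Integer using (+_)
open import Data.Rational using (ℚ; 0ℚ; 1ℚ; _+_; _*_; _-_; _/_; ∣_∣; _≤_)
open import Data.Rational.Properties using (_≤?_; _≟_)
open import Data.Product using (_×_; _,_)
open import Relation.Binary.PropositionalEquality using (_≡_)
open import Relation.Nullary.Decidable using (⌊_⌋)

-- A directed graph on n nodes, given by its adjacency matrix A (A u v = true iff u → v).
-- Bool entries: no multi-edges.
Adj : ℕ → Set
Adj n = Fin n → Fin n → Bool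

Simple : ∀ {n} → Adj n → Set
Simple A = ∀ u → A u u ≡ false

Vecℚ : ℕ → Set
Vecℚ n = Fin n → ℚ

sumℕ : ∀ {n} → (Fin n → ℕ) → ℕ
sumℕ {n} f = foldr (λ i acc → f i ℕ.+ acc) 0 (allFin n)

sumℚ : ∀ {n} → (Fin n → ℚ) → ℚ
sumℚ {n} f = foldr (λ i acc → f i + acc) 0ℚ (allFin n)

outdeg : ∀ {n} → Adj n → Fin n → ℕ
outdeg A u = sumℕ (λ v → if A u v then 1 else 0)

fromℕ : ℕ → ℚ
fromℕ k = (+ k) / 1

-- 1/d (with the harmless convention 1/0 = 0; degrees are ≥ 1 under the hypotheses)
inv : ℕ → ℚ
inv zero = 0ℚ
inv (suc k) = (+ 1) / suc k

e : ∀ {n} → Fin n → Vecℚ n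
e s v = if ⌊ s ≟ᶠ v ⌋ then 1ℚ else 0ℚ

l1 : ∀ {n} → Vecℚ n → ℚ
l1 v = sumℚ (λ i → ∣ v i ∣)

_-ᵥ_ : ∀ {n} → Vecℚ n → Vecℚ n → Vecℚ n
(a -ᵥ b) i = a i - b i

IsPPR : ∀ {n} → Adj n → ℚ → Fin n → Vecℚ n → Set
IsPPR A α s x = ∀ v →
  x v ≡ α * e s v + (1ℚ - α) * sumℚ (λ u → if A u v then x u * inv (outdeg A u) else 0ℚ)

_∈?_ : ∀ {n} → Fin n → List (Fin n) → Bool
v ∈? L = any (λ w → ⌊ w ≟ᶠ v ⌋) L

isActive : ∀ {n} → Adj n → ℚ → Vecℚ n → Fin n → Bool
isActive A ε r v = ⌊ ε * fromℕ (outdeg A v) ≤? r v ⌋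

update : ∀ {n} → Vecℚ n → Fin n → ℚ → Vecℚ n
update f u a w = if ⌊ u ≟ᶠ w ⌋ then a else f w

-- Processing the out-neighbours of u (in increasing index order):
-- r_v ← r_v + δ, and append v to the next-epoch part N of the FIFO queue if
-- r_v ≥ ε d_v and v is not in the queue (L = rest of current epoch, N = after dummy).
neighLoop : ∀ {n} → Adj n → ℚ → Fin n → ℚ → List (Fin n) →
            List (Fin n) → Vecℚ n × List (Fin n) → Vecℚ n × List (Fin n)
neighLoop A ε u δ L [] (r , N) = r , N
neighLoop A ε u δ L (v ∷ vs) (r , N) with A u v
... | false = neighLoop A ε u δ L vs (r , N)
... | true  =
  let r' = update r v (r v + δ)
      N' = if isActive A ε r' v ∧ not (v ∈? (L ++ N))
             then N ++ (v ∷ []) else N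
  in neighLoop A ε u δ L vs (r' , N')

-- one push of node u (already popped; L = remaining current-epoch queue, N = next-epoch queue)
push : ∀ {n} → Adj n → ℚ → ℚ → Fin n → List (Fin n) →
       Vecℚ n × Vecℚ n × List (Fin n) → Vecℚ n × Vecℚ n × List (Fin n)
push {n} A ε α u L (x , r , N) =
  let ru = r u
      x' = update x u (x u + α * ru)
      δ  = (1ℚ - α) * ru * inv (outdeg A u)
  in case' (neighLoop A ε u δ L (allFin n) (r , N)) x'
  where
  case' : Vecℚ n × List (Fin n) → Vecℚ n → Vecℚ n × Vecℚ n × List (Fin n)
  case' (r' , N') x' = x' , update r' u 0ℚ , N'

epochGo : ∀ {n} → Adj n → ℚ → ℚ → List (Fin n) →
          Vecℚ n × Vecℚ n × List (Fin n) → Vecℚ n × Vecℚ n × List (Fin n)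
epochGo A ε α [] st = st
epochGo A ε α (u ∷ L) st = epochGo A ε α L (push A ε α u L st)

-- state of FwdPush: estimate x, residual r, queue content (excluding the dummy)
record State (n : ℕ) : Set where
  constructor st
  field
    xv : Vecℚ n
    rv : Vecℚ n
    queue : List (Fin n)
open State public

epoch : ∀ {n} → Adj n → ℚ → ℚ → State n → State n
epoch A ε α (st x r Q) with epochGo A ε α Q (x , r , [])
... | x' , r' , N = st x' r' N

-- state at the beginning of epoch t (epoch 0 starts with x = 0, r = e_s, Q = [s, ‡]);
-- once the queue is empty the algorithm has stopped and the state stays fixed.
stateAt : ∀ {n} → Adj n → ℚ → ℚ → Fin n → ℕ → State n
stateAt A ε α s zero = st (λ _ → 0ℚ) (e s) (s ∷ [])
stateAt A ε α s (suc t) = epoch A ε α (stateAt A ε α s t)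

xAt rAt : ∀ {n} → Adj n → ℚ → ℚ → Fin n → ℕ → Vecℚ n
xAt A ε α s t = xv (stateAt A ε α s t)
rAt A ε α s t = rv (stateAt A ε α s t)

sumDegS : ∀ {n} → Adj n → ℚ → Vecℚ n → ℕ
sumDegS A ε r = sumℕ (λ u → if isActive A ε r u then outdeg A u else 0)

-- Σ_{v ∈ I_t} d_v  with I_t = supp r
sumDegI : ∀ {n} → Adj n → Vecℚ n → ℕ
sumDegI A r = sumℕ (λ v → if ⌊ r v ≟ 0ℚ ⌋ then 0 else outdeg A v)

-- ratio a / b of naturals, with convention 0 when b = 0 (only when I_t = ∅, i.e. r^t = 0)
ratio : ℕ → ℕ → ℚ
ratio a zero = 0ℚ
ratio a (suc b) = (+ a) / suc b

γ : ∀ {n} → Adj n → ℚ → ℚ → Fin n → ℕ → ℚ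
γ A ε α s t = ratio (sumDegS A ε (rAt A ε α s t)) (sumDegI A (rAt A ε α s t))

{-# OPTIONS --safe #-}
module Submission where

-- The error x* − x of the estimate is at all times the PPR vector of the residual:
-- x* − x = α r + (1 − α) AᵀD⁻¹ (x* − x) with r ≥ 0.  As AᵀD⁻¹ preserves total mass, this
-- forces ‖x* − x‖₁ = Σ r.  Pushing u moves α r_u into x and spreads (1 − α) r_u over the
-- out-neighbours of u, none of which is u, so Σ r drops by exactly α r_u, while the residuals
-- of the nodes still waiting in the queue only grow.  Every node of S_t is queued exactly once
-- at the start of epoch t, so the epoch removes at least α Σ_{u ∈ S_t} r_u.  Finally
-- ε d_u ≤ r_u on S_t and r_v < ε d_v on U_t give Σ_{u ∈ S_t} r_u ≥ γ_t Σ r (a mediant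
-- inequality), so Σ r, and with it the error, shrinks by the factor 1 − α γ_t.

open import Defs
open import Algebra.Bundles using (Ring)
open import Data.Bool using (Bool; true; false; if_then_else_; _∧_; _∨_; not; T)
open import Data.Bool.Properties using (∨-assoc; ∨-zeroʳ; ∨-conicalˡ; ∧-identityʳ; ∧-zeroʳ)
open import Data.Fin using (Fin)
import Data.Fin as Fin
import Data.Fin.Properties as Fin
open import Data.Fin.Properties using () renaming (_≟_ to _≟ᶠ_)
import Data.Integer as ℤ
import Data.Integer.Properties as ℤ
import Data.List
open import Data.List using (List; []; _∷_; _++_; tabulate; allFin)
open import Data.List.Properties using (++-assoc; ++-identityʳ)
open import Data.Nat as ℕ using (ℕ; zero; suc; _≥_)
import Data.Nat.Properties as ℕ
open import Data.Nat.Coprimality using (1-coprimeTo) renaming (sym to coprime-sym)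
open import Data.Product using (_×_; _,_; proj₁; proj₂)
open import Data.Rational
  using (ℚ; mkℚ; 0ℚ; 1ℚ; _+_; _*_; _-_; -_; ∣_∣; _≤_; _<_; nonNegative; positive)
open import Data.Rational.Properties
open import Data.Rational.Solver using (module +-*-Solver)
open import Data.Unit using (⊤; tt)
import Data.Vec.Functional as Vector
open import Function using (_∘_; id)
open import Relation.Binary.PropositionalEquality
open import Relation.Nullary using (¬_; yes; no; contradiction)
open import Relation.Nullary.Decidable
  using (Dec; ⌊_⌋; isYes≗does; dec-true; dec-false; toWitness; toWitnessFalse)

open import Algebra.Properties.Semiring.Sum (Ring.semiring +-*-ring)
  using (sum; sum-cong-≗; sum-replicate-zero; ∑-distrib-+; ∑-comm; *-distribˡ-sum)

open +-*-Solver

-- Rational arithmetic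

*-monoˡ-≤-0≤ : ∀ {c p q} → 0ℚ ≤ c → p ≤ q → c * p ≤ c * q
*-monoˡ-≤-0≤ {c} 0≤c = *-monoˡ-≤-nonNeg c {{nonNegative 0≤c}}

*-cancelˡ-≤-0< : ∀ {c p q} → 0ℚ < c → c * p ≤ c * q → p ≤ q
*-cancelˡ-≤-0< {c} 0<c = *-cancelˡ-≤-pos c {{positive 0<c}}

0≤* : ∀ {p q} → 0ℚ ≤ p → 0ℚ ≤ q → 0ℚ ≤ p * q
0≤* {p} {q} 0≤p 0≤q = ≤-trans (≤-reflexive (sym (*-zeroʳ p))) (*-monoˡ-≤-0≤ 0≤p 0≤q)

if-≤ : ∀ b {p q} → (b ≡ true → p ≤ q) → 0ℚ ≤ q → (if b then p else 0ℚ) ≤ q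
if-≤ true p≤q _ = p≤q refl
if-≤ false _ 0≤q = 0≤q

if-∧-not-≡0 : ∀ a b p → (a ≡ true → b ≡ true) → (if a ∧ not b then p else 0ℚ) ≡ 0ℚ
if-∧-not-≡0 true b p a⇒b rewrite a⇒b refl = refl
if-∧-not-≡0 false b p _ = refl

if-nonNeg : ∀ b {p} → 0ℚ ≤ p → 0ℚ ≤ (if b then p else 0ℚ)
if-nonNeg true 0≤p = 0≤p
if-nonNeg false _ = ≤-refl

if-nonNeg′ : ∀ b {p} → 0ℚ ≤ p → 0ℚ ≤ (if b then 0ℚ else p)
if-nonNeg′ true _ = ≤-refl
if-nonNeg′ false 0≤p = 0≤p

p≤q⇒0≤q-p : ∀ {p q} → p ≤ q → 0ℚ ≤ q - p
p≤q⇒0≤q-p {p} p≤q = ≤-trans (≤-reflexive (sym (+-inverseʳ p))) (+-monoˡ-≤ (- p) p≤q)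

p≤p+q : ∀ p {q} → 0ℚ ≤ q → p ≤ p + q
p≤p+q p {q} 0≤q = ≤-trans (≤-reflexive (sym (+-identityʳ p))) (+-monoʳ-≤ p 0≤q)

fixpoint-≤ : ∀ {α a b} → 0ℚ < α → a ≤ α * b + (1ℚ - α) * a → a ≤ b
fixpoint-≤ {α} {a} {b} 0<α a≤ = *-cancelˡ-≤-0< 0<α (begin
  α * a                                ≡⟨ solve 2 (λ α a → α :* a := a :- (con 1ℚ :- α) :* a) refl α a ⟩
  a - (1ℚ - α) * a                     ≤⟨ +-monoˡ-≤ (- ((1ℚ - α) * a)) a≤ ⟩
  α * b + (1ℚ - α) * a - (1ℚ - α) * a  ≡⟨ solve 2 (λ c d → c :+ d :- d := c) refl (α * b) ((1ℚ - α) * a) ⟩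
  α * b                                ∎)
  where open ≤-Reasoning

fixpoint-≥ : ∀ {α a b} → 0ℚ < α → α * b + (1ℚ - α) * a ≤ a → b ≤ a
fixpoint-≥ {α} {a} {b} 0<α ≤a = *-cancelˡ-≤-0< 0<α (begin
  α * b                                ≡⟨ solve 2 (λ c d → c := c :+ d :- d) refl (α * b) ((1ℚ - α) * a) ⟩
  α * b + (1ℚ - α) * a - (1ℚ - α) * a  ≤⟨ +-monoˡ-≤ (- ((1ℚ - α) * a)) ≤a ⟩
  a - (1ℚ - α) * a                     ≡⟨ solve 2 (λ α a → a :- (con 1ℚ :- α) :* a := α :* a) refl α a ⟩
  α * a                                ∎)
  where open ≤-Reasoning

p≤∣p∣ : ∀ p → p ≤ ∣ p ∣
p≤∣p∣ p@(mkℚ (ℤ.+ _) _ _) = ≤-refl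
p≤∣p∣ p@(mkℚ ℤ.-[1+ _ ] _ _) = ≤-trans (<⇒≤ (negative⁻¹ p)) (0≤∣p∣ p)

mediant-≤ : ∀ {ε s t a b} → 0ℚ ≤ a → 0ℚ ≤ b → ε * a ≤ s → t ≤ ε * b → a * (s + t) ≤ (a + b) * s
mediant-≤ {ε} {s} {t} {a} {b} 0≤a 0≤b εa≤s t≤εb = begin
  a * (s + t)          ≡⟨ *-distribˡ-+ a s t ⟩
  a * s + a * t        ≤⟨ +-monoʳ-≤ (a * s) (*-monoˡ-≤-0≤ 0≤a t≤εb) ⟩
  a * s + a * (ε * b)  ≡⟨ cong (a * s +_) (solve 3 (λ a ε b → a :* (ε :* b) := b :* (ε :* a)) refl a ε b) ⟩
  a * s + b * (ε * a)  ≤⟨ +-monoʳ-≤ (a * s) (*-monoˡ-≤-0≤ 0≤b εa≤s) ⟩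
  a * s + b * s        ≡⟨ *-distribʳ-+ s a b ⟨
  (a + b) * s          ∎
  where open ≤-Reasoning

-- Naturals in ℚ

fromℕ≡mkℚ : ∀ k → fromℕ k ≡ mkℚ (ℤ.+ k) 0 (coprime-sym (1-coprimeTo k))
fromℕ≡mkℚ k = normalize-coprime (coprime-sym (1-coprimeTo k))

inv-suc≡mkℚ : ∀ k → inv (suc k) ≡ mkℚ (ℤ.+ 1) k (1-coprimeTo (suc k))
inv-suc≡mkℚ k = normalize-coprime (1-coprimeTo (suc k))

fromℕ-+ : ∀ a b → fromℕ (a ℕ.+ b) ≡ fromℕ a + fromℕ b
fromℕ-+ a b rewrite fromℕ≡mkℚ a | fromℕ≡mkℚ b
  | ℤ.*-identityʳ (ℤ.+ a) | ℤ.*-identityʳ (ℤ.+ b) = refl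

fromℕ-nonNeg : ∀ k → 0ℚ ≤ fromℕ k
fromℕ-nonNeg k rewrite fromℕ≡mkℚ k = nonNegative⁻¹ _

fromℕ-pos : ∀ {k} → k ≥ 1 → 0ℚ < fromℕ k
fromℕ-pos {suc k} _ rewrite fromℕ≡mkℚ (suc k) = positive⁻¹ _

inv-nonNeg : ∀ k → 0ℚ ≤ inv k
inv-nonNeg zero = ≤-refl
inv-nonNeg (suc k) rewrite inv-suc≡mkℚ k = nonNegative⁻¹ _

inv-inverseˡ : ∀ {k} → k ≥ 1 → inv k * fromℕ k ≡ 1ℚ
inv-inverseˡ {suc k} _ rewrite inv-suc≡mkℚ k | fromℕ≡mkℚ (suc k) =
  *-inverseˡ (mkℚ (ℤ.+ suc k) 0 (coprime-sym (1-coprimeTo (suc k))))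

ratio-suc : ∀ a b → ratio a (suc b) ≡ fromℕ a * inv (suc b)
ratio-suc a b rewrite inv-suc≡mkℚ b | fromℕ≡mkℚ a
  | ℤ.*-identityʳ (ℤ.+ a) | ℕ.+-identityʳ b = refl

ratio-*-≤ : ∀ a b {p q} → 0ℚ ≤ q → fromℕ a * p ≤ fromℕ b * q → ratio a b * p ≤ q
ratio-*-≤ a zero {p} 0≤q _ = ≤-trans (≤-reflexive (*-zeroˡ p)) 0≤q
ratio-*-≤ a (suc b) {p} {q} _ ap≤bq rewrite ratio-suc a b = begin
  fromℕ a * inv (suc b) * p            ≡⟨ solve 3 (λ a i p → a :* i :* p := i :* (a :* p)) refl (fromℕ a) (inv (suc b)) p ⟩
  inv (suc b) * (fromℕ a * p)          ≤⟨ *-monoˡ-≤-0≤ (inv-nonNeg (suc b)) ap≤bq ⟩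
  inv (suc b) * (fromℕ (suc b) * q)    ≡⟨ sym (*-assoc (inv (suc b)) (fromℕ (suc b)) q) ⟩
  inv (suc b) * fromℕ (suc b) * q      ≡⟨ cong (_* q) (inv-inverseˡ {suc b} (ℕ.s≤s ℕ.z≤n)) ⟩
  1ℚ * q                               ≡⟨ *-identityˡ q ⟩
  q                                    ∎
  where open ≤-Reasoning

-- Finite sums

foldr-tabulate : ∀ {A B : Set} (_∙_ : B → B → B) (e : B) {n} (g : Fin n → A) (f : A → B) →
  Data.List.foldr (λ i acc → f i ∙ acc) e (tabulate g) ≡ Vector.foldr _∙_ e (f ∘ g)
foldr-tabulate _∙_ e {zero} g f = refl
foldr-tabulate _∙_ e {suc n} g f = cong (f (g Fin.zero) ∙_) (foldr-tabulate _∙_ e (g ∘ Fin.suc) f)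

sumℚ≡sum : ∀ {n} (f : Vecℚ n) → sumℚ f ≡ sum f
sumℚ≡sum f = foldr-tabulate _+_ 0ℚ id f

fromℕ-sumℕ : ∀ {n} (f : Fin n → ℕ) → fromℕ (sumℕ f) ≡ sum (fromℕ ∘ f)
fromℕ-sumℕ f = trans (cong fromℕ (foldr-tabulate ℕ._+_ 0 id f)) (fromℕ-foldr f)
  where
  fromℕ-foldr : ∀ {n} (f : Fin n → ℕ) → fromℕ (Vector.foldr ℕ._+_ 0 f) ≡ sum (fromℕ ∘ f)
  fromℕ-foldr {zero} f = refl
  fromℕ-foldr {suc n} f = trans (fromℕ-+ (f Fin.zero) _) (cong (fromℕ (f Fin.zero) +_) (fromℕ-foldr (f ∘ Fin.suc)))

sum-mono-≤ : ∀ {n} {f g : Vecℚ n} → (∀ i → f i ≤ g i) → sum f ≤ sum g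
sum-mono-≤ {zero} f≤g = ≤-refl
sum-mono-≤ {suc n} f≤g = +-mono-≤ (f≤g Fin.zero) (sum-mono-≤ (f≤g ∘ Fin.suc))

sum-nonNeg : ∀ {n} {f : Vecℚ n} → (∀ i → 0ℚ ≤ f i) → 0ℚ ≤ sum f
sum-nonNeg {n} 0≤f = ≤-trans (≤-reflexive (sym (sum-replicate-zero n))) (sum-mono-≤ 0≤f)

∣sum∣≤sum∣∣ : ∀ {n} (f : Vecℚ n) → ∣ sum f ∣ ≤ sum (∣_∣ ∘ f)
∣sum∣≤sum∣∣ {zero} f = ≤-refl
∣sum∣≤sum∣∣ {suc n} f =
  ≤-trans (∣p+q∣≤∣p∣+∣q∣ (f Fin.zero) (sum (f ∘ Fin.suc)))
          (+-monoʳ-≤ ∣ f Fin.zero ∣ (∣sum∣≤sum∣∣ (f ∘ Fin.suc)))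

sum-update : ∀ {n} (f g : Vecℚ n) (u : Fin n) → (∀ i → i ≢ u → f i ≡ g i) →
  sum f ≡ sum g + (f u - g u)
sum-update f g Fin.zero f≡g rewrite sum-cong-≗ (λ i → f≡g (Fin.suc i) λ ()) =
  solve 3 (λ a b s → a :+ s := b :+ s :+ (a :- b)) refl (f Fin.zero) (g Fin.zero) _
sum-update f g (Fin.suc u) f≡g
  rewrite f≡g Fin.zero (λ ())
        | sum-update (f ∘ Fin.suc) (g ∘ Fin.suc) u (λ i i≢u → f≡g (Fin.suc i) (i≢u ∘ Fin.suc-injective)) =
  sym (+-assoc (g Fin.zero) (sum (g ∘ Fin.suc)) (f (Fin.suc u) - g (Fin.suc u)))

sum-single : ∀ {n} (f : Vecℚ n) (u : Fin n) → (∀ i → i ≢ u → f i ≡ 0ℚ) → sum f ≡ f u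
sum-single {n} f u f≡0 = begin
  sum f                                 ≡⟨ sum-update f (λ _ → 0ℚ) u f≡0 ⟩
  sum (λ (_ : Fin n) → 0ℚ) + (f u - 0ℚ) ≡⟨ cong (_+ (f u - 0ℚ)) (sum-replicate-zero n) ⟩
  0ℚ + (f u - 0ℚ)                       ≡⟨ solve 1 (λ a → con 0ℚ :+ (a :- con 0ℚ) := a) refl (f u) ⟩
  f u                                   ∎
  where open ≡-Reasoning

-- Decisions, updates and queues

module _ {p} {P : Set p} (P? : Dec P) where

  ⌊⌋-true : P → ⌊ P? ⌋ ≡ true
  ⌊⌋-true x = trans (isYes≗does P?) (dec-true P? x)

  ⌊⌋-false : ¬ P → ⌊ P? ⌋ ≡ false
  ⌊⌋-false ¬x = trans (isYes≗does P?) (dec-false P? ¬x)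

  ⌊⌋-true⁻¹ : ⌊ P? ⌋ ≡ true → P
  ⌊⌋-true⁻¹ h = toWitness (subst T (sym h) tt)

  ⌊⌋-false⁻¹ : ⌊ P? ⌋ ≡ false → ¬ P
  ⌊⌋-false⁻¹ h = toWitnessFalse (subst (T ∘ not) (sym h) tt)

split-at : ∀ {n} {u : Fin n} (P : Fin n → Set) → P u → (∀ {v} → u ≢ v → P v) → ∀ v → P v
split-at {u = u} P Pu Pv v with u ≟ᶠ v
... | yes refl = Pu
... | no u≢v = Pv u≢v

update-same : ∀ {n} (f : Vecℚ n) u a → update f u a u ≡ a
update-same f u a rewrite ⌊⌋-true (u ≟ᶠ u) refl = refl

update-other : ∀ {n} (f : Vecℚ n) {u w} a → u ≢ w → update f u a w ≡ f w
update-other f {u} {w} a u≢w rewrite ⌊⌋-false (u ≟ᶠ w) u≢w = refl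

module _ {n : ℕ} where

  ∈?-++ : ∀ (v : Fin n) xs ys → v ∈? (xs ++ ys) ≡ v ∈? xs ∨ v ∈? ys
  ∈?-++ v [] ys = refl
  ∈?-++ v (w ∷ xs) ys rewrite ∈?-++ v xs ys = sym (∨-assoc ⌊ w ≟ᶠ v ⌋ (v ∈? xs) (v ∈? ys))

  ∈?-∷-≢ : ∀ {v w : Fin n} xs → v ≢ w → w ∈? (v ∷ xs) ≡ w ∈? xs
  ∈?-∷-≢ {v} {w} xs v≢w = cong (_∨ _) (⌊⌋-false (v ≟ᶠ w) v≢w)

  Distinct : List (Fin n) → Set
  Distinct [] = ⊤
  Distinct (v ∷ vs) = v ∈? vs ≡ false × Distinct vs

  Distinct-∷ʳ : ∀ {vs} {v : Fin n} → Distinct vs → v ∈? vs ≡ false → Distinct (vs ++ v ∷ [])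
  Distinct-∷ʳ {[]} _ _ = refl , tt
  Distinct-∷ʳ {w ∷ vs} {v} (w∉vs , dist) v∉w∷vs with w ≟ᶠ v
  ... | yes _ = contradiction v∉w∷vs λ ()
  ... | no w≢v = w∉vs∷ʳv , Distinct-∷ʳ dist v∉w∷vs
    where
    w∉vs∷ʳv : w ∈? (vs ++ v ∷ []) ≡ false
    w∉vs∷ʳv rewrite ∈?-++ w vs (v ∷ []) | w∉vs | ⌊⌋-false (v ≟ᶠ w) (w≢v ∘ sym) = refl

  module _ (L N : List (Fin n)) (v : Fin n) where

    enqueue-Distinct : ∀ a → Distinct (L ++ N) → Distinct (L ++ (if a ∧ not (v ∈? (L ++ N)) then N ++ v ∷ [] else N))
    enqueue-Distinct a dist with a | v ∈? (L ++ N) in v∈?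
    ... | true  | false = subst Distinct (++-assoc L N (v ∷ [])) (Distinct-∷ʳ dist v∈?)
    ... | true  | true  = dist
    ... | false | _     = dist

    enqueue-⊇ : ∀ a w → w ∈? (L ++ N) ≡ true → w ∈? (L ++ (if a ∧ not (v ∈? (L ++ N)) then N ++ v ∷ [] else N)) ≡ true
    enqueue-⊇ a w w∈ with a ∧ not (v ∈? (L ++ N))
    ... | false = w∈
    ... | true rewrite sym (++-assoc L N (v ∷ [])) | ∈?-++ w (L ++ N) (v ∷ []) | w∈ = refl

    enqueue-∋ : v ∈? (L ++ (if true ∧ not (v ∈? (L ++ N)) then N ++ v ∷ [] else N)) ≡ true
    enqueue-∋ with v ∈? (L ++ N) in v∈?
    ... | true = v∈?
    ... | false rewrite sym (++-assoc L N (v ∷ [])) | ∈?-++ v (L ++ N) (v ∷ []) | ⌊⌋-true (v ≟ᶠ v) refl =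
      ∨-zeroʳ (v ∈? (L ++ N))

-- PPR vectors

AᵀD⁻¹ : ∀ {n} → Adj n → Vecℚ n → Vecℚ n
AᵀD⁻¹ A y v = sum (λ w → if A w v then y w * inv (outdeg A w) else 0ℚ)

IsPPRof : ∀ {n} → Adj n → ℚ → Vecℚ n → Vecℚ n → Set
IsPPRof A α r y = ∀ v → y v ≡ α * r v + (1ℚ - α) * AᵀD⁻¹ A y v

module _ {n} (A : Adj n) where

  sum-out : ∀ u c → sum (λ v → if A u v then c else 0ℚ) ≡ c * fromℕ (outdeg A u)
  sum-out u c = begin
    sum (λ v → if A u v then c else 0ℚ)                     ≡⟨ sum-cong-≗ (λ v → if-scale (A u v)) ⟩
    sum (λ v → c * fromℕ (if A u v then 1 else 0))          ≡⟨ *-distribˡ-sum c (fromℕ ∘ edge) ⟨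
    c * sum (λ v → fromℕ (if A u v then 1 else 0))          ≡⟨ cong (c *_) (fromℕ-sumℕ edge) ⟨
    c * fromℕ (outdeg A u)                                  ∎
    where
    open ≡-Reasoning
    edge : Fin n → ℕ
    edge v = if A u v then 1 else 0
    if-scale : ∀ b → (if b then c else 0ℚ) ≡ c * fromℕ (if b then 1 else 0)
    if-scale true = sym (*-identityʳ c)
    if-scale false = sym (*-zeroʳ c)

  sum-out-share : ∀ {u} → outdeg A u ≥ 1 → ∀ c → sum (λ v → if A u v then c * inv (outdeg A u) else 0ℚ) ≡ c
  sum-out-share {u} d≥1 c = begin
    sum (λ v → if A u v then c * inv (outdeg A u) else 0ℚ) ≡⟨ sum-out u (c * inv (outdeg A u)) ⟩
    c * inv (outdeg A u) * fromℕ (outdeg A u)              ≡⟨ *-assoc c _ _ ⟩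
    c * (inv (outdeg A u) * fromℕ (outdeg A u))            ≡⟨ cong (c *_) (inv-inverseˡ d≥1) ⟩
    c * 1ℚ                                                 ≡⟨ *-identityʳ c ⟩
    c                                                      ∎
    where open ≡-Reasoning

  sum-AᵀD⁻¹ : (∀ u → outdeg A u ≥ 1) → ∀ y → sum (AᵀD⁻¹ A y) ≡ sum y
  sum-AᵀD⁻¹ d≥1 y = trans (∑-comm (λ v w → if A w v then y w * inv (outdeg A w) else 0ℚ))
                          (sum-cong-≗ (λ w → sum-out-share (d≥1 w) (y w)))

  ∣AᵀD⁻¹∣≤AᵀD⁻¹∣∣ : ∀ y v → ∣ AᵀD⁻¹ A y v ∣ ≤ AᵀD⁻¹ A (∣_∣ ∘ y) v
  ∣AᵀD⁻¹∣≤AᵀD⁻¹∣∣ y v = ≤-trans (∣sum∣≤sum∣∣ (λ w → if A w v then y w * inv (outdeg A w) else 0ℚ))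
                                 (≤-reflexive (sum-cong-≗ (λ w → ∣if∣ (A w v) w)))
    where
    ∣if∣ : ∀ b w → ∣ (if b then y w * inv (outdeg A w) else 0ℚ) ∣ ≡ (if b then ∣ y w ∣ * inv (outdeg A w) else 0ℚ)
    ∣if∣ true w = trans (∣p*q∣≡∣p∣*∣q∣ (y w) _) (cong (∣ y w ∣ *_) (0≤p⇒∣p∣≡p (inv-nonNeg (outdeg A w))))
    ∣if∣ false w = refl

  sum-PPR : (∀ u → outdeg A u ≥ 1) → ∀ α r y →
    sum (λ v → α * r v + (1ℚ - α) * AᵀD⁻¹ A y v) ≡ α * sum r + (1ℚ - α) * sum y
  sum-PPR d≥1 α r y = begin
    sum (λ v → α * r v + (1ℚ - α) * AᵀD⁻¹ A y v)
      ≡⟨ ∑-distrib-+ (λ v → α * r v) (λ v → (1ℚ - α) * AᵀD⁻¹ A y v) ⟩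
    sum (λ v → α * r v) + sum (λ v → (1ℚ - α) * AᵀD⁻¹ A y v)
      ≡⟨ cong₂ _+_ (*-distribˡ-sum α r) (*-distribˡ-sum (1ℚ - α) (AᵀD⁻¹ A y)) ⟨
    α * sum r + (1ℚ - α) * sum (AᵀD⁻¹ A y)
      ≡⟨ cong (λ s → α * sum r + (1ℚ - α) * s) (sum-AᵀD⁻¹ d≥1 y) ⟩
    α * sum r + (1ℚ - α) * sum y                        ∎
    where open ≡-Reasoning

  l1-PPR : (∀ u → outdeg A u ≥ 1) → ∀ {α r y} → 0ℚ < α → α < 1ℚ → (∀ v → 0ℚ ≤ r v) →
    IsPPRof A α r y → l1 y ≡ sum r
  l1-PPR d≥1 {α} {r} {y} 0<α α<1 0≤r ppr = trans (sumℚ≡sum (∣_∣ ∘ y)) (≤-antisym ∑∣y∣≤∑r ∑r≤∑∣y∣)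
    where
    0≤1-α : 0ℚ ≤ 1ℚ - α
    0≤1-α = p≤q⇒0≤q-p (<⇒≤ α<1)

    ∣y∣≤ : ∀ v → ∣ y v ∣ ≤ α * r v + (1ℚ - α) * AᵀD⁻¹ A (∣_∣ ∘ y) v
    ∣y∣≤ v = begin
      ∣ y v ∣                                        ≡⟨ cong ∣_∣ (ppr v) ⟩
      ∣ α * r v + (1ℚ - α) * AᵀD⁻¹ A y v ∣           ≤⟨ ∣p+q∣≤∣p∣+∣q∣ (α * r v) _ ⟩
      ∣ α * r v ∣ + ∣ (1ℚ - α) * AᵀD⁻¹ A y v ∣       ≡⟨ cong₂ _+_ (0≤p⇒∣p∣≡p (0≤* (<⇒≤ 0<α) (0≤r v)))
                                                       (trans (∣p*q∣≡∣p∣*∣q∣ (1ℚ - α) _)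
                                                              (cong (_* _) (0≤p⇒∣p∣≡p 0≤1-α))) ⟩
      α * r v + (1ℚ - α) * ∣ AᵀD⁻¹ A y v ∣
        ≤⟨ +-monoʳ-≤ (α * r v) (*-monoˡ-≤-0≤ 0≤1-α (∣AᵀD⁻¹∣≤AᵀD⁻¹∣∣ y v)) ⟩
      α * r v + (1ℚ - α) * AᵀD⁻¹ A (∣_∣ ∘ y) v       ∎
      where open ≤-Reasoning

    ∑∣y∣≤∑r : sum (∣_∣ ∘ y) ≤ sum r
    ∑∣y∣≤∑r = fixpoint-≤ 0<α (≤-trans (sum-mono-≤ ∣y∣≤) (≤-reflexive (sum-PPR d≥1 α r (∣_∣ ∘ y))))

    ∑r≤∑∣y∣ : sum r ≤ sum (∣_∣ ∘ y)
    ∑r≤∑∣y∣ = ≤-trans (fixpoint-≥ 0<α (≤-reflexive (sym (trans (sum-cong-≗ ppr) (sum-PPR d≥1 α r y)))))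
                      (sum-mono-≤ (p≤∣p∣ ∘ y))

  IsPPR⇒IsPPRof : ∀ {α s x} → IsPPR A α s x → IsPPRof A α (e s) (x -ᵥ (λ _ → 0ℚ))
  IsPPR⇒IsPPRof {α} {s} {x} ppr v = begin
    x v - 0ℚ                                             ≡⟨ +-identityʳ (x v) ⟩
    x v                                                  ≡⟨ ppr v ⟩
    α * e s v + (1ℚ - α) * sumℚ (share x)                ≡⟨ cong (λ z → α * e s v + (1ℚ - α) * z) (sumℚ≡sum (share x)) ⟩
    α * e s v + (1ℚ - α) * sum (share x)                 ≡⟨ cong (λ z → α * e s v + (1ℚ - α) * z) (sum-cong-≗ x≡x-0) ⟩
    α * e s v + (1ℚ - α) * AᵀD⁻¹ A (x -ᵥ (λ _ → 0ℚ)) v  ∎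
    where
    open ≡-Reasoning
    share : Vecℚ n → Vecℚ n
    share y u = if A u v then y u * inv (outdeg A u) else 0ℚ
    x≡x-0 : ∀ u → share x u ≡ share (x -ᵥ (λ _ → 0ℚ)) u
    x≡x-0 u = cong (λ q → if A u v then q * inv (outdeg A u) else 0ℚ) (sym (+-identityʳ (x u)))

-- Forward push

module _ {n} (A : Adj n) (ε : ℚ) where

  isActive-cong : ∀ (r r′ : Vecℚ n) {w} → r′ w ≡ r w → isActive A ε r′ w ≡ isActive A ε r w
  isActive-cong _ _ {w} = cong (λ q → ⌊ ε * fromℕ (outdeg A w) ≤? q ⌋)

  active⇒≥ : ∀ r {w} → isActive A ε r w ≡ true → ε * fromℕ (outdeg A w) ≤ r w
  active⇒≥ r = ⌊⌋-true⁻¹ (_ ≤? _)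

  inactive⇒< : ∀ r {w} → isActive A ε r w ≡ false → r w < ε * fromℕ (outdeg A w)
  inactive⇒< r = ≰⇒> ∘ ⌊⌋-false⁻¹ (_ ≤? _)

  module _ (0<ε : 0ℚ < ε) where

    0<threshold : ∀ {w} → outdeg A w ≥ 1 → 0ℚ < ε * fromℕ (outdeg A w)
    0<threshold d≥1 = ≤-<-trans (≤-reflexive (sym (*-zeroʳ ε))) (*-monoʳ-<-pos ε {{positive 0<ε}} (fromℕ-pos d≥1))

    zero-inactive : ∀ {r w} → outdeg A w ≥ 1 → r w ≡ 0ℚ → isActive A ε r w ≡ false
    zero-inactive {r} d≥1 r≡0 =
      trans (isActive-cong (λ _ → 0ℚ) r r≡0)
            (⌊⌋-false (_ ≤? 0ℚ) (λ t≤0 → <-irrefl refl (<-≤-trans (0<threshold d≥1) t≤0)))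

module NeighbourLoop {n} (A : Adj n) (ε : ℚ) (u : Fin n) (δ : ℚ) (L : List (Fin n)) where

  loop : List (Fin n) → Vecℚ n × List (Fin n) → Vecℚ n × List (Fin n)
  loop = neighLoop A ε u δ L

  hits : Fin n → List (Fin n) → ℚ
  hits w = Data.List.foldr (λ v acc → (if A u v ∧ ⌊ v ≟ᶠ w ⌋ then δ else 0ℚ) + acc) 0ℚ

  loop-residual : ∀ vs r N w → proj₁ (loop vs (r , N)) w ≡ r w + hits w vs
  loop-residual [] r N w = sym (+-identityʳ (r w))
  loop-residual (v ∷ vs) r N w with A u v
  ... | false = trans (loop-residual vs r N w) (cong (r w +_) (sym (+-identityˡ (hits w vs))))
  ... | true = trans (loop-residual vs _ _ w) (bump (v ≟ᶠ w))
    where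
    bump : Dec (v ≡ w) → update r v (r v + δ) w + hits w vs ≡ r w + ((if ⌊ v ≟ᶠ w ⌋ then δ else 0ℚ) + hits w vs)
    bump (yes refl) rewrite update-same r v (r v + δ) | ⌊⌋-true (v ≟ᶠ v) refl = +-assoc (r v) δ (hits v vs)
    bump (no v≢w) rewrite update-other r (r v + δ) v≢w | ⌊⌋-false (v ≟ᶠ w) v≢w =
      cong (r w +_) (sym (+-identityˡ (hits w vs)))

  hits-allFin : ∀ w → hits w (allFin n) ≡ (if A u w then δ else 0ℚ)
  hits-allFin w = begin
    hits w (allFin n)
      ≡⟨ foldr-tabulate _+_ 0ℚ id (λ v → if A u v ∧ ⌊ v ≟ᶠ w ⌋ then δ else 0ℚ) ⟩
    sum (λ v → if A u v ∧ ⌊ v ≟ᶠ w ⌋ then δ else 0ℚ)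
      ≡⟨ sum-single _ w off-target ⟩
    (if A u w ∧ ⌊ w ≟ᶠ w ⌋ then δ else 0ℚ)
      ≡⟨ cong (λ b → if A u w ∧ b then δ else 0ℚ) (⌊⌋-true (w ≟ᶠ w) refl) ⟩
    (if A u w ∧ true then δ else 0ℚ)
      ≡⟨ cong (λ b → if b then δ else 0ℚ) (∧-identityʳ (A u w)) ⟩
    (if A u w then δ else 0ℚ)
      ∎
    where
    open ≡-Reasoning
    off-target : ∀ v → v ≢ w → (if A u v ∧ ⌊ v ≟ᶠ w ⌋ then δ else 0ℚ) ≡ 0ℚ
    off-target v v≢w rewrite ⌊⌋-false (v ≟ᶠ w) v≢w | ∧-zeroʳ (A u v) = refl

  -- Pitfall: neighLoop's new queue is written out verbatim below, not through an abbreviation, and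
  -- the invariant is a record.  Otherwise unification or the normalisation done by `with` unfolds
  -- isActive on open rationals, which is very slow.
  record LoopInvariant (s : Vecℚ n × List (Fin n)) : Set where
    field
      distinct : Distinct (L ++ proj₂ s)
      enqueued : ∀ w → w ≢ u → isActive A ε (proj₁ s) w ≡ true → w ∈? (L ++ proj₂ s) ≡ true

  visit-invariant : ∀ {r N} v → LoopInvariant (r , N) →
    let r′ = update r v (r v + δ) in
    LoopInvariant (r′ , (if isActive A ε r′ v ∧ not (v ∈? (L ++ N)) then N ++ v ∷ [] else N))
  visit-invariant {r} {N} v inv = record
    { distinct = enqueue-Distinct L N v (isActive A ε r′ v) distinct
    ; enqueued = split-at Goal
        (λ _ act → subst (λ a → v ∈? (L ++ (if a ∧ not (v ∈? (L ++ N)) then N ++ v ∷ [] else N)) ≡ true)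
                         (sym act) (enqueue-∋ L N v))
        (λ {w} v≢w w≢u act → enqueue-⊇ L N v _ w
           (enqueued w w≢u (trans (sym (isActive-cong A ε r r′ (update-other r (r v + δ) v≢w))) act)))
    }
    where
    open LoopInvariant inv
    r′ : Vecℚ n
    r′ = update r v (r v + δ)
    Goal : Fin n → Set
    Goal w = w ≢ u → isActive A ε r′ w ≡ true →
             w ∈? (L ++ (if isActive A ε r′ v ∧ not (v ∈? (L ++ N)) then N ++ v ∷ [] else N)) ≡ true

  loop-invariant : ∀ vs r N → LoopInvariant (r , N) → LoopInvariant (loop vs (r , N))
  loop-invariant [] r N inv = inv
  loop-invariant (v ∷ vs) r N inv with A u v
  ... | false = loop-invariant vs r N inv
  ... | true = loop-invariant vs _ _ (visit-invariant v inv)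

module PushStep {n} (A : Adj n) (ε α : ℚ) (u : Fin n) (L : List (Fin n)) (x r : Vecℚ n) (N : List (Fin n)) where

  δ : ℚ
  δ = (1ℚ - α) * r u * inv (outdeg A u)

  open NeighbourLoop A ε u δ L

  x′ r-loop r′ : Vecℚ n
  r-loop = proj₁ (loop (allFin n) (r , N))
  x′ = proj₁ (push A ε α u L (x , r , N))
  r′ = proj₁ (proj₂ (push A ε α u L (x , r , N)))

  N′ : List (Fin n)
  N′ = proj₂ (proj₂ (push A ε α u L (x , r , N)))

  residual-self : r′ u ≡ 0ℚ
  residual-self = update-same r-loop u 0ℚ

  residual-other : ∀ {w} → u ≢ w → r′ w ≡ r w + (if A u w then δ else 0ℚ)
  residual-other {w} u≢w = begin
    r′ w                             ≡⟨ update-other r-loop 0ℚ u≢w ⟩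
    r-loop w                         ≡⟨ loop-residual (allFin n) r N w ⟩
    r w + hits w (allFin n)          ≡⟨ cong (r w +_) (hits-allFin w) ⟩
    r w + (if A u w then δ else 0ℚ)  ∎
    where open ≡-Reasoning

  estimate-self : x′ u ≡ x u + α * r u
  estimate-self = update-same x u (x u + α * r u)

  estimate-other : ∀ {w} → u ≢ w → x′ w ≡ x w
  estimate-other = update-other x (x u + α * r u)

  -- Without self-loops, none of the (1 − α) r_u spread by u lands on u itself.
  sum-residual : Simple A → outdeg A u ≥ 1 → sum r′ ≡ sum r - α * r u
  sum-residual simple d≥1 = begin
    sum r′
      ≡⟨ sum-update r′ r+δ u (λ w w≢u → residual-other (w≢u ∘ sym)) ⟩
    sum r+δ + (r′ u - r+δ u)
      ≡⟨ cong₂ (λ s t → s + (t - r+δ u)) (∑-distrib-+ r _) residual-self ⟩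
    sum r + sum (λ w → if A u w then δ else 0ℚ) + (0ℚ - r+δ u)
      ≡⟨ cong₂ (λ s t → sum r + s + (0ℚ - (r u + t))) (sum-out-share A d≥1 ((1ℚ - α) * r u))
               (cong (λ b → if b then δ else 0ℚ) (simple u)) ⟩
    sum r + (1ℚ - α) * r u + (0ℚ - (r u + 0ℚ))
      ≡⟨ solve 3 (λ s α q → s :+ (con 1ℚ :- α) :* q :+ (con 0ℚ :- (q :+ con 0ℚ)) := s :- α :* q)
                 refl (sum r) α (r u) ⟩
    sum r - α * r u
      ∎
    where
    open ≡-Reasoning
    r+δ : Vecℚ n
    r+δ w = r w + (if A u w then δ else 0ℚ)

  residual-grows : 0ℚ ≤ δ → ∀ {w} → u ≢ w → r w ≤ r′ w
  residual-grows 0≤δ {w} u≢w = ≤-trans (p≤p+q (r w) (0≤if (A u w))) (≤-reflexive (sym (residual-other u≢w)))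
    where
    0≤if : ∀ b → 0ℚ ≤ (if b then δ else 0ℚ)
    0≤if true = 0≤δ
    0≤if false = ≤-refl

  queue-invariant : Distinct ((u ∷ L) ++ N) → (∀ w → isActive A ε r w ≡ true → w ∈? ((u ∷ L) ++ N) ≡ true) →
    LoopInvariant (loop (allFin n) (r , N))
  queue-invariant (_ , dist) enq =
    loop-invariant (allFin n) r N record
      { distinct = dist
      ; enqueued = λ w w≢u act → trans (sym (∈?-∷-≢ (L ++ N) (w≢u ∘ sym))) (enq w act)
      }

  enqueued-after : 0ℚ < ε → outdeg A u ≥ 1 → LoopInvariant (loop (allFin n) (r , N)) →
    ∀ w → isActive A ε r′ w ≡ true → w ∈? (L ++ N′) ≡ true
  enqueued-after 0<ε d≥1 inv = split-at (λ w → isActive A ε r′ w ≡ true → w ∈? (L ++ N′) ≡ true)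
    (λ act → contradiction (trans (sym (zero-inactive A ε 0<ε {r′} d≥1 residual-self)) act) λ ())
    (λ {w} u≢w act → LoopInvariant.enqueued inv w (u≢w ∘ sym)
       (trans (sym (isActive-cong A ε r-loop r′ (update-other r-loop 0ℚ u≢w))) act))

  module _ (xstar : Vecℚ n) where

    private
      y y′ P : Vecℚ n
      y = xstar -ᵥ x
      y′ = xstar -ᵥ x′
      P = AᵀD⁻¹ A y

      share : ℚ → Bool → ℚ
      share c b = if b then c * inv (outdeg A u) else 0ℚ

    gap-self : y′ u ≡ y u - α * r u
    gap-self = trans (cong (λ q → xstar u - q) estimate-self)
                     (solve 3 (λ s a b → s :- (a :+ b) := s :- a :- b) refl (xstar u) (x u) (α * r u))

    gap-other : ∀ {w} → u ≢ w → y′ w ≡ y w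
    gap-other u≢w = cong (λ q → xstar _ - q) (estimate-other u≢w)

    AᵀD⁻¹-gap : ∀ v → AᵀD⁻¹ A y′ v ≡ P v + (share (y u - α * r u) (A u v) - share (y u) (A u v))
    AᵀD⁻¹-gap v = begin
      AᵀD⁻¹ A y′ v
        ≡⟨ sum-update _ _ u (λ w w≢u → cong (λ q → if A w v then q * inv (outdeg A w) else 0ℚ)
                                            (gap-other (w≢u ∘ sym))) ⟩
      P v + (share (y′ u) (A u v) - share (y u) (A u v)) ≡⟨ cong (λ q → P v + (share q (A u v) - share (y u) (A u v))) gap-self ⟩
      P v + (share (y u - α * r u) (A u v) - share (y u) (A u v)) ∎
      where open ≡-Reasoning

    PPR-self : Simple A → IsPPRof A α r y → y′ u ≡ α * r′ u + (1ℚ - α) * AᵀD⁻¹ A y′ u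
    PPR-self simple ppr = begin
      y′ u                                                    ≡⟨ gap-self ⟩
      y u - α * r u                                           ≡⟨ cong (_- α * r u) (ppr u) ⟩
      α * r u + (1ℚ - α) * P u - α * r u
        ≡⟨ solve 3 (λ α q p → α :* q :+ (con 1ℚ :- α) :* p :- α :* q
                             := α :* con 0ℚ :+ (con 1ℚ :- α) :* (p :+ (con 0ℚ :- con 0ℚ)))
                                                                   refl α (r u) (P u) ⟩
      α * 0ℚ + (1ℚ - α) * (P u + (0ℚ - 0ℚ))
        ≡⟨ cong₂ (λ s b → α * s + (1ℚ - α) * (P u + (share (y u - α * r u) b - share (y u) b)))
                 residual-self (simple u) ⟨
      α * r′ u + (1ℚ - α) * (P u + (share (y u - α * r u) (A u u) - share (y u) (A u u)))
        ≡⟨ cong (λ p → α * r′ u + (1ℚ - α) * p) (AᵀD⁻¹-gap u) ⟨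
      α * r′ u + (1ℚ - α) * AᵀD⁻¹ A y′ u                       ∎
      where open ≡-Reasoning
    PPR-other : IsPPRof A α r y → ∀ {v} → u ≢ v → y′ v ≡ α * r′ v + (1ℚ - α) * AᵀD⁻¹ A y′ v
    PPR-other ppr {v} u≢v = begin
      y′ v                                                    ≡⟨ gap-other u≢v ⟩
      y v                                                     ≡⟨ ppr v ⟩
      α * r v + (1ℚ - α) * P v                                ≡⟨ rebalance (A u v) ⟩
      α * (r v + (if A u v then δ else 0ℚ)) + (1ℚ - α) * (P v + (share (y u - α * r u) (A u v) - share (y u) (A u v)))
        ≡⟨ cong₂ (λ s p → α * s + (1ℚ - α) * p) (residual-other u≢v) (AᵀD⁻¹-gap v) ⟨
      α * r′ v + (1ℚ - α) * AᵀD⁻¹ A y′ v                       ∎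
      where
      open ≡-Reasoning
      -- The α δ added to r v cancels the (1 − α) α r u / d u removed from AᵀD⁻¹ y′ v.
      rebalance : ∀ b → α * r v + (1ℚ - α) * P v
                      ≡ α * (r v + (if b then δ else 0ℚ)) + (1ℚ - α) * (P v + (share (y u - α * r u) b - share (y u) b))
      rebalance true = solve 6 (λ α q p yu qu i → α :* q :+ (con 1ℚ :- α) :* p
                                                 := α :* (q :+ (con 1ℚ :- α) :* qu :* i)
                                                    :+ (con 1ℚ :- α) :* (p :+ ((yu :- α :* qu) :* i :- yu :* i)))
                               refl α (r v) (P v) (y u) (r u) (inv (outdeg A u))
      rebalance false = solve 3 (λ α q p → α :* q :+ (con 1ℚ :- α) :* p
                                           := α :* (q :+ con 0ℚ) :+ (con 1ℚ :- α) :* (p :+ (con 0ℚ :- con 0ℚ)))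
                              refl α (r v) (P v)

    PPR-preserved : Simple A → IsPPRof A α r (xstar -ᵥ x) → IsPPRof A α r′ (xstar -ᵥ x′)
    PPR-preserved simple ppr = split-at _ (PPR-self simple ppr) (PPR-other ppr)

module Epoch {n} (A : Adj n) (simple : Simple A) (d≥1 : ∀ u → outdeg A u ≥ 1)
             {α ε : ℚ} (0<α : 0ℚ < α) (α<1 : α < 1ℚ) (0<ε : 0ℚ < ε) (xstar : Vecℚ n) where

  done : Vecℚ n → List (Fin n) → Vecℚ n
  done r₀ L w = if isActive A ε r₀ w ∧ not (w ∈? L) then r₀ w else 0ℚ

  activeMass : Vecℚ n → ℚ
  activeMass r = sum (λ w → if isActive A ε r w then r w else 0ℚ)

  -- Inside an epoch that began with residual r₀: L is what remains of the epoch's queue, N the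
  -- queue built for the next epoch, and done r₀ L the part of r₀ on S already pushed.
  record Invariant (r₀ : Vecℚ n) (L : List (Fin n)) (x r : Vecℚ n) (N : List (Fin n)) : Set where
    field
      distinct : Distinct (L ++ N)
      enqueued : ∀ w → isActive A ε r w ≡ true → w ∈? (L ++ N) ≡ true
      grown    : ∀ w → w ∈? L ≡ true → r₀ w ≤ r w
      nonNeg   : ∀ w → 0ℚ ≤ r w
      ppr      : IsPPRof A α r (xstar -ᵥ x)
      progress : sum r + α * sum (done r₀ L) ≤ sum r₀


  module _ {r₀ u L x r N} (inv : Invariant r₀ (u ∷ L) x r N) where
    open Invariant inv
    open PushStep A ε α u L x r N

    private
      u∉L : u ∈? L ≡ false
      u∉L = ∨-conicalˡ (u ∈? L) (u ∈? N) (trans (sym (∈?-++ u L N)) (proj₁ distinct))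

      u≢L : ∀ {w} → w ∈? L ≡ true → u ≢ w
      u≢L w∈L refl = contradiction (trans (sym u∉L) w∈L) λ ()

      0≤δ : 0ℚ ≤ δ
      0≤δ = 0≤* (0≤* (p≤q⇒0≤q-p (<⇒≤ α<1)) (nonNeg u)) (inv-nonNeg (outdeg A u))

      done-popped : ∀ w → w ≢ u → done r₀ (u ∷ L) w ≡ done r₀ L w
      done-popped w w≢u = cong (λ b → if isActive A ε r₀ w ∧ not b then r₀ w else 0ℚ) (∈?-∷-≢ L (w≢u ∘ sym))

      done-head : done r₀ (u ∷ L) u ≡ 0ℚ
      done-head = trans (cong (λ b → if isActive A ε r₀ u ∧ not (b ∨ u ∈? L) then r₀ u else 0ℚ)
                              (⌊⌋-true (u ≟ᶠ u) refl))
                        (cong (λ b → if b then r₀ u else 0ℚ) (∧-zeroʳ (isActive A ε r₀ u)))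

      done-new≤ : done r₀ L u ≤ r u
      done-new≤ = if-≤ (isActive A ε r₀ u ∧ not (u ∈? L))
                       (λ _ → grown u (cong (_∨ u ∈? L) (⌊⌋-true (u ≟ᶠ u) refl))) (nonNeg u)

      done-gain≤ : done r₀ L u - done r₀ (u ∷ L) u ≤ r u
      done-gain≤ = ≤-trans (≤-reflexive (trans (cong (λ q → done r₀ L u - q) done-head) (+-identityʳ (done r₀ L u))))
                           done-new≤

      progress′ : sum r′ + α * sum (done r₀ L) ≤ sum r₀
      progress′ = begin
        sum r′ + α * sum (done r₀ L)
          ≡⟨ cong₂ (λ s t → s + α * t) (sum-residual simple (d≥1 u))
                   (sum-update (done r₀ L) (done r₀ (u ∷ L)) u (λ w w≢u → sym (done-popped w w≢u))) ⟩
        sum r - α * r u + α * (D + (done r₀ L u - done r₀ (u ∷ L) u))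
          ≤⟨ +-monoʳ-≤ (sum r - α * r u) (*-monoˡ-≤-0≤ (<⇒≤ 0<α) (+-monoʳ-≤ D done-gain≤)) ⟩
        sum r - α * r u + α * (D + r u)
          ≡⟨ solve 4 (λ s α q d → s :- α :* q :+ α :* (d :+ q) := s :+ α :* d) refl (sum r) α (r u) D ⟩
        sum r + α * D
          ≤⟨ progress ⟩
        sum r₀ ∎
        where
        open ≤-Reasoning
        D = sum (done r₀ (u ∷ L))

    push-preserves : Invariant r₀ L x′ r′ N′
    push-preserves = record
      { distinct = LoopInvariant.distinct loopInv
      ; enqueued = enqueued-after 0<ε (d≥1 u) loopInv
      ; grown    = λ w w∈L → ≤-trans (grown w (trans (∈?-∷-≢ L (u≢L w∈L)) w∈L)) (residual-grows 0≤δ (u≢L w∈L))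
      ; nonNeg   = split-at (λ w → 0ℚ ≤ r′ w) (≤-reflexive (sym residual-self))
                            (λ {w} u≢w → ≤-trans (nonNeg w) (residual-grows 0≤δ u≢w))
      ; ppr      = PPR-preserved xstar simple ppr
      ; progress = progress′
      }
      where
      open NeighbourLoop A ε u δ L using (LoopInvariant; module LoopInvariant)
      loopInv = queue-invariant distinct enqueued

  Invariantᵗ : Vecℚ n → List (Fin n) → Vecℚ n × Vecℚ n × List (Fin n) → Set
  Invariantᵗ r₀ L (x , r , N) = Invariant r₀ L x r N

  epochGo-preserves : ∀ {r₀} L s → Invariantᵗ r₀ L s → Invariantᵗ r₀ [] (epochGo A ε α L s)
  epochGo-preserves [] s inv = inv
  epochGo-preserves (u ∷ L) (x , r , N) inv = epochGo-preserves L (push A ε α u L (x , r , N)) (push-preserves inv)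

  record Consistent (s : State n) : Set where
    field
      distinct : Distinct (queue s)
      enqueued : ∀ w → isActive A ε (rv s) w ≡ true → w ∈? queue s ≡ true
      nonNeg   : ∀ w → 0ℚ ≤ rv s w
      ppr      : IsPPRof A α (rv s) (xstar -ᵥ xv s)

  epoch-start : ∀ {x r Q} → Consistent (st x r Q) → Invariant r Q x r []
  epoch-start {x} {r} {Q} c = record
    { distinct = subst Distinct (sym (++-identityʳ Q)) distinct
    ; enqueued = λ w act → trans (cong (w ∈?_) (++-identityʳ Q)) (enqueued w act)
    ; grown    = λ w _ → ≤-refl
    ; nonNeg   = nonNeg
    ; ppr      = ppr
    ; progress = ≤-reflexive (begin
        sum r + α * sum (done r Q)   ≡⟨ cong (λ s → sum r + α * s) (trans (sum-cong-≗ nothing-done) (sum-replicate-zero n)) ⟩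
        sum r + α * 0ℚ               ≡⟨ solve 2 (λ s α → s :+ α :* con 0ℚ := s) refl (sum r) α ⟩
        sum r                        ∎)
    }
    where
    open Consistent c
    open ≡-Reasoning
    nothing-done : ∀ w → done r Q w ≡ 0ℚ
    nothing-done w = if-∧-not-≡0 (isActive A ε r w) (w ∈? Q) (r w) (enqueued w)

  epoch-end : ∀ {r₀ x r N} → Invariant r₀ [] x r N → Consistent (st x r N) × sum r + α * activeMass r₀ ≤ sum r₀
  epoch-end {r₀} {x} {r} {N} inv = consistent , subst (λ m → sum r + α * m ≤ sum r₀) (sum-cong-≗ all-done) progress
    where
    open Invariant inv
    consistent : Consistent (st x r N)
    consistent = record { distinct = distinct ; enqueued = enqueued ; nonNeg = nonNeg ; ppr = ppr }
    all-done : ∀ w → done r₀ [] w ≡ (if isActive A ε r₀ w then r₀ w else 0ℚ)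
    all-done w = cong (λ b → if b then r₀ w else 0ℚ) (∧-identityʳ (isActive A ε r₀ w))

  epoch-step : ∀ s → Consistent s →
    Consistent (epoch A ε α s) × sum (rv (epoch A ε α s)) + α * activeMass (rv s) ≤ sum (rv s)
  epoch-step (st x r Q) c = epoch-end (epochGo-preserves Q (x , r , []) (epoch-start c))

  γ-bound : ∀ r → (∀ w → 0ℚ ≤ r w) → ratio (sumDegS A ε r) (sumDegI A r) * sum r ≤ activeMass r
  γ-bound r 0≤r = ratio-*-≤ (sumDegS A ε r) (sumDegI A r) (sum-nonNeg (λ w → if-nonNeg (active w) (0≤r w)))
    (begin
      fromℕ (sumDegS A ε r) * sum r       ≡⟨ cong₂ _*_ degS mass ⟩
      sum dS * (activeMass r + sum rU)
        ≤⟨ mediant-≤ {ε} (sum-nonNeg (λ w → if-nonNeg (active w) (fromℕ-nonNeg (outdeg A w))))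
                         (sum-nonNeg (λ w → if-nonNeg′ (active w) (if-nonNeg′ (zero? w) (fromℕ-nonNeg (outdeg A w)))))
                                                        active-mass inert-mass ⟩
      (sum dS + sum dU) * activeMass r     ≡⟨ cong (_* activeMass r) degI ⟨
      fromℕ (sumDegI A r) * activeMass r  ∎)
    where
    open ≤-Reasoning
    active zero? : Fin n → Bool
    active w = isActive A ε r w
    zero? w = ⌊ r w ≟ 0ℚ ⌋

    -- I_t = S_t ∪ U_t, since active nodes have positive residual.
    dS dU rU : Vecℚ n
    dS w = if active w then fromℕ (outdeg A w) else 0ℚ
    dU w = if active w then 0ℚ else (if zero? w then 0ℚ else fromℕ (outdeg A w))
    rU w = if active w then 0ℚ else r w

    active⇒nonzero : ∀ w → active w ≡ true → zero? w ≡ false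
    active⇒nonzero w act = ⌊⌋-false (r w ≟ 0ℚ) λ r≡0 →
      <-irrefl (sym r≡0) (<-≤-trans (0<threshold A ε 0<ε (d≥1 w)) (active⇒≥ A ε r act))

    degS : fromℕ (sumDegS A ε r) ≡ sum dS
    degS = trans (fromℕ-sumℕ (λ w → if active w then outdeg A w else 0)) (sum-cong-≗ (λ w → fromℕ-if (active w)))
      where
      fromℕ-if : ∀ b {k} → fromℕ (if b then k else 0) ≡ (if b then fromℕ k else 0ℚ)
      fromℕ-if true = refl
      fromℕ-if false = refl

    degI : fromℕ (sumDegI A r) ≡ sum dS + sum dU
    degI = trans (fromℕ-sumℕ (λ w → if zero? w then 0 else outdeg A w))
                 (trans (sum-cong-≗ (λ w → split (active w) (zero? w) (active⇒nonzero w))) (∑-distrib-+ dS dU))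
      where
      split : ∀ a z {k} → (a ≡ true → z ≡ false) →
        fromℕ (if z then 0 else k) ≡ (if a then fromℕ k else 0ℚ) + (if a then 0ℚ else (if z then 0ℚ else fromℕ k))
      split true z {k} a⇒z rewrite a⇒z refl = sym (+-identityʳ (fromℕ k))
      split false true _ = refl
      split false false {k} _ = sym (+-identityˡ (fromℕ k))

    mass : sum r ≡ activeMass r + sum rU
    mass = trans (sum-cong-≗ (λ w → split (active w) (r w))) (∑-distrib-+ _ rU)
      where
      split : ∀ b p → p ≡ (if b then p else 0ℚ) + (if b then 0ℚ else p)
      split true p = sym (+-identityʳ p)
      split false p = sym (+-identityˡ p)

    active-mass : ε * sum dS ≤ activeMass r
    active-mass = ≤-trans (≤-reflexive (*-distribˡ-sum ε dS)) (sum-mono-≤ (λ w → bound (active w) (active⇒≥ A ε r)))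
      where
      bound : ∀ {w} b → (b ≡ true → ε * fromℕ (outdeg A w) ≤ r w) →
        ε * (if b then fromℕ (outdeg A w) else 0ℚ) ≤ (if b then r w else 0ℚ)
      bound true h = h refl
      bound false _ = ≤-reflexive (*-zeroʳ ε)

    inert-mass : sum rU ≤ ε * sum dU
    inert-mass = ≤-trans (sum-mono-≤ (λ w → bound (active w) (zero? w) (inactive⇒< A ε r) (⌊⌋-true⁻¹ (r w ≟ 0ℚ))))
                         (≤-reflexive (sym (*-distribˡ-sum ε dU)))
      where
      bound : ∀ {w} a z → (a ≡ false → r w < ε * fromℕ (outdeg A w)) → (z ≡ true → r w ≡ 0ℚ) →
        (if a then 0ℚ else r w) ≤ ε * (if a then 0ℚ else (if z then 0ℚ else fromℕ (outdeg A w)))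
      bound true _ _ _ = ≤-reflexive (sym (*-zeroʳ ε))
      bound false true _ r≡0 = ≤-reflexive (trans (r≡0 refl) (sym (*-zeroʳ ε)))
      bound false false r< _ = <⇒≤ (r< refl)

  residual-contraction : ∀ s → Consistent s →
    sum (rv (epoch A ε α s)) ≤ (1ℚ - α * ratio (sumDegS A ε (rv s)) (sumDegI A (rv s))) * sum (rv s)
  residual-contraction s c = begin
    sum r′                            ≡⟨ solve 2 (λ a b → a := a :+ b :- b) refl (sum r′) (α * activeMass r) ⟩
    sum r′ + α * activeMass r - α * activeMass r
      ≤⟨ +-monoˡ-≤ (- (α * activeMass r)) (proj₂ (epoch-step s c)) ⟩
    sum r - α * activeMass r
      ≤⟨ +-monoʳ-≤ (sum r) (neg-antimono-≤ (*-monoˡ-≤-0≤ (<⇒≤ 0<α) (γ-bound r (Consistent.nonNeg c)))) ⟩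
    sum r - α * (γₛ * sum r)
      ≡⟨ solve 3 (λ α g q → q :- α :* (g :* q) := (con 1ℚ :- α :* g) :* q) refl α γₛ (sum r) ⟩
    (1ℚ - α * γₛ) * sum r             ∎
    where
    open ≤-Reasoning
    r r′ : Vecℚ n
    r = rv s
    r′ = rv (epoch A ε α s)
    γₛ : ℚ
    γₛ = ratio (sumDegS A ε r) (sumDegI A r)

  module _ {s} (ppr : IsPPR A α s xstar) where

    initial-consistent : Consistent (stateAt A ε α s zero)
    initial-consistent = record
      { distinct = refl , tt
      ; enqueued = split-at (λ w → isActive A ε (e s) w ≡ true → w ∈? (s ∷ []) ≡ true)
          (λ _ → cong (_∨ false) (⌊⌋-true (s ≟ᶠ s) refl))
          (λ {w} s≢w act → contradiction (trans (sym (zero-inactive A ε 0<ε {e s} (d≥1 w) (e-other s≢w))) act) λ ())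
      ; nonNeg   = λ w → if-nonNeg ⌊ s ≟ᶠ w ⌋ (nonNegative⁻¹ 1ℚ)
      ; ppr      = IsPPR⇒IsPPRof A {α} {s} ppr
      }
      where
      e-other : ∀ {w} → s ≢ w → e s w ≡ 0ℚ
      e-other {w} s≢w = cong (λ b → if b then 1ℚ else 0ℚ) (⌊⌋-false (s ≟ᶠ w) s≢w)

    consistent : ∀ t → Consistent (stateAt A ε α s t)
    consistent zero = initial-consistent
    consistent (suc t) = proj₁ (epoch-step _ (consistent t))

lemma3 : (n : ℕ) (A : Adj n) → Simple A → (∀ u → outdeg A u ≥ 1) →
    (α ε : ℚ) → 0ℚ < α → α < 1ℚ → 0ℚ < ε → (s : Fin n) →
    (xstar : Vecℚ n) → IsPPR A α s xstar →
    (t : ℕ) →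
      l1 (xstar -ᵥ xAt A ε α s (suc t))
        ≤ (1ℚ - α * γ A ε α s t) * l1 (xstar -ᵥ xAt A ε α s t)
lemma3 n A simple d≥1 α ε 0<α α<1 0<ε s xstar ppr t = begin
  l1 (xstar -ᵥ xAt A ε α s (suc t))             ≡⟨ l1-PPR A d≥1 0<α α<1 (nonNeg c′) (Consistent.ppr c′) ⟩
  sum (rAt A ε α s (suc t))                      ≤⟨ residual-contraction (stateAt A ε α s t) c ⟩
  (1ℚ - α * γ A ε α s t) * sum (rAt A ε α s t)
    ≡⟨ cong ((1ℚ - α * γ A ε α s t) *_) (l1-PPR A d≥1 0<α α<1 (nonNeg c) (Consistent.ppr c)) ⟨
  (1ℚ - α * γ A ε α s t) * l1 (xstar -ᵥ xAt A ε α s t) ∎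
  where
  open ≤-Reasoning
  open Epoch A simple d≥1 0<α α<1 0<ε xstar
  open Consistent using (nonNeg)
  c c′ : Consistent _
  c = consistent ppr t
  c′ = consistent ppr (suc t)
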